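{- For every integer $n\ge 1$ and every $k\ge 1$, the number of $e\in\mathbf{I}_n(021)$ having exactly $k$ entries equal to $0$ equals the number of Schröder $(n-1)$-paths having exactly $k-1$ flat steps.
   Context: An inversion sequence of length $n$ is an integer sequence $e=(e_1,\ldots,e_n)$ with $0 \le e_i < i$ for all $i$; $\mathbf{I}_n$ is the set of these. $\mathbf{I}_n(021)$ is the set of $e\in\mathbf{I}_n$ with no indices $i<j<k$ such that $e_i<e_k<e_j$. A Schröder $m$-path is a lattice path from $(0,0)$ to $(2m,0)$ never going below the $x$-axis, with steps $U=(1,1)$ (up), $D=(1,-1)$ (down), $F=(2,0)$ (flat). -}

module Defs where

open import Data.Nat using (ℕ; zero; suc; _+_; _<_; _≟_; _<ᵇ_)
open import Data.Bool using (Bool; T; not; _∧_)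
open import Data.Bool.ListAction using (any)
open import Data.Fin using (Fin; toℕ)
open import Data.List using (List; []; _∷_; length; filter)
open import Data.List using (allFin)
open import Data.Product using (Σ; _×_; ∃-syntax; proj₁)
open import Data.Vec using (Vec; lookup)
open import Data.List.Relation.Unary.All using (All)
open import Data.Empty using (⊥)
open import Data.Unit using (⊤)
open import Relation.Binary.PropositionalEquality using (_≡_)
open import Relation.Nullary using (¬_)

-- Represented as a vector of naturals together with the bound proofs
-- (a first-order representation, so that equality is decidable and
-- no function extensionality is needed).
-- Index i : Fin n stands for position i+1, so the condition is e_{i+1} < i+1.
IsInvSeq : ∀ {n} → Vec ℕ n → Set
IsInvSeq {n} v = All (λ i → lookup v i < suc (toℕ i)) (allFin n)

InvSeq : ℕ → Set
InvSeq n = Σ (Vec ℕ n) IsInvSeq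

val : ∀ {n} → InvSeq n → Fin n → ℕ
val e i = lookup (proj₁ e) i

Occ021 : ∀ {n} → InvSeq n → Fin n → Fin n → Fin n → Bool
Occ021 e i j k =
  (toℕ i <ᵇ toℕ j) ∧ (toℕ j <ᵇ toℕ k) ∧
  (val e i <ᵇ val e k) ∧ (val e k <ᵇ val e j)

-- Stated as a Boolean check over all index triples (T of a Bool, so the
-- property has unique proofs and no function extensionality is needed).
avoids021 : ∀ {n} → InvSeq n → Bool
avoids021 {n} e =
  not (any (λ i → any (λ j → any (λ k → Occ021 e i j k) (allFin n)) (allFin n)) (allFin n))

Avoids021 : ∀ {n} → InvSeq n → Set
Avoids021 e = T (avoids021 e)

zeros : ∀ {n} → InvSeq n → ℕ
zeros {n} e = length (filter (λ i → val e i ≟ 0) (allFin n))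

-- Schröder paths: steps U=(1,1), D=(1,-1), F=(2,0)
data Step : Set where
  U D F : Step

ValidFrom : ℕ → List Step → Set
ValidFrom zero    []      = ⊤
ValidFrom (suc h) []      = ⊥
ValidFrom h       (U ∷ s) = ValidFrom (suc h) s
ValidFrom zero    (D ∷ s) = ⊥
ValidFrom (suc h) (D ∷ s) = ValidFrom h s
ValidFrom h       (F ∷ s) = ValidFrom h s

width : List Step → ℕ
width []      = 0
width (U ∷ s) = 1 + width s
width (D ∷ s) = 1 + width s
width (F ∷ s) = 2 + width s

IsSchroderPath : ℕ → List Step → Set
IsSchroderPath m s = ValidFrom 0 s × width s ≡ m + m

flats : List Step → ℕ
flats []      = 0
flats (F ∷ s) = suc (flats s)
flats (_ ∷ s) = flats s

module Submission where

-- Every Schröder path and every 021-avoiding inversion sequence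
-- is read as a word describing the same kind of tree: a tree is a leaf, a
-- binary node or a unary "flat" node, and the theorem follows from four
-- bijections, each preserving a size and a "flat" statistic.
--
-- 1. Trees ↔ Schröder paths.  A tree is flattened last-return style
--    (node l r ↦ l U r D, flat r ↦ r F) and a path is parsed back by a
--    left-to-right stack machine; the flats of the path are the flat nodes.
-- 2. Trees ↔ admissible codes.  A code is a word in letters z and p d
--    (a Łukasiewicz-type word, p d meaning "close d open levels, open one");
--    again flattening and a stack machine are mutually inverse.
-- 3. Codes ↔ admissible tails.  A tail is a vector whose positive entries
--    weakly increase and satisfy the inversion bounds; it is encoded by
--    its zeros (letter z) and its successive positive increments (letter p).
-- 4. Tails ↔ 021-avoiding inversion sequences.  Such a sequence starts with
--    0, and a sequence starting with 0 avoids 021 exactly when its positive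
--    entries weakly increase; removing the leading 0 gives the tail.
--
-- The zeros of the sequence become, in turn, the zeros of the tail (one fewer),
-- the letters z, the flat nodes and the flat steps of the path.

open import Defs
open import Data.Nat using (ℕ; zero; suc; _+_; _∸_; _≤_; _<_; z≤n; s≤s; _≟_; _≤?_)
open import Data.Nat.Properties
  using ( +-suc; +-assoc; +-identityʳ; +-comm; suc-injective; ≡-irrelevant
        ; ≤-irrelevant; <-irrelevant; ≤-trans; m≤m+n; m≤n⇒m≤1+n; <⇒≱; n≮0; ≰⇒>
        ; m+n∸m≡n; m+[n∸m]≡n; +-∸-assoc; ∸-+-assoc; ∸-monoˡ-≤; m≤o∸n⇒m+n≤o
        ; ≤-pred; <ᵇ⇒<; <⇒<ᵇ )
open import Data.Nat.Tactic.RingSolver using (solve-∀)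
open import Data.Bool using (Bool; true; false; T; not; _∧_)
open import Data.Bool.Properties using (T-irrelevant; T-∧)
open import Data.Bool.ListAction using (any)
open import Data.Fin using (Fin; toℕ) renaming (zero to fzero; suc to fsuc)
open import Data.Vec using (Vec; []; _∷_; lookup)
import Data.Vec as Vec
open import Data.Vec.Properties using (tabulate∘lookup)
open import Data.List using (List; []; _∷_; length; filter; tabulate; allFin)
import Data.List.Relation.Unary.All as All
import Data.List.Relation.Unary.All.Properties as All
import Data.List.Relation.Unary.Any.Properties as Any
open import Data.Product using (Σ; _×_; _,_; proj₁)
open import Data.Sum using (_⊎_; inj₁; inj₂)
open import Data.Unit using (⊤; tt)
open import Data.Empty using (⊥-elim)
open import Function.Base using (id)
open import Function.Bundles using (_↔_; mk↔ₛ′; Equivalence)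
open import Function.Properties.Inverse using (↔-trans)
open import Relation.Nullary using (¬_; yes; no)
open import Relation.Nullary.Irrelevant using (Irrelevant)
open import Relation.Binary.PropositionalEquality
  using (_≡_; refl; sym; trans; cong; cong₂; subst; module ≡-Reasoning)

×-irrelevant : {A B : Set} → Irrelevant A → Irrelevant B → Irrelevant (A × B)
×-irrelevant irrA irrB (a , b) (a′ , b′) = cong₂ _,_ (irrA a a′) (irrB b b′)

-- Mutually inverse maps between the underlying sets that respect the
-- predicates give a bijection of the Σ-types, once the predicates are
-- propositions (so that only the first components need to be compared).
Σ-↔ : {A B : Set} {P : A → Set} {Q : B → Set}
  (f : ∀ a → P a → B) (g : ∀ b → Q b → A)
  (f-ok : ∀ a pa → Q (f a pa)) (g-ok : ∀ b qb → P (g b qb)) →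
  (∀ a pa → g (f a pa) (f-ok a pa) ≡ a) → (∀ b qb → f (g b qb) (g-ok b qb) ≡ b) →
  (∀ a → Irrelevant (P a)) → (∀ b → Irrelevant (Q b)) →
  Σ A P ↔ Σ B Q
Σ-↔ f g f-ok g-ok g∘f f∘g irrP irrQ =
  mk↔ₛ′ (λ (a , pa) → f a pa , f-ok a pa) (λ (b , qb) → g b qb , g-ok b qb)
    (λ (b , qb) → Σ-≡ irrQ (f∘g b qb))
    (λ (a , pa) → Σ-≡ irrP (g∘f a pa))
  where
  Σ-≡ : {C : Set} {R : C → Set} → (∀ c → Irrelevant (R c)) →
        {c c′ : C} {r : R c} {r′ : R c′} → c ≡ c′ → (c , r) ≡ (c′ , r′)
  Σ-≡ irr {c} {r = r} {r′} refl = cong (c ,_) (irr c r r′)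

+-double-injective : ∀ {a b} → a + a ≡ b + b → a ≡ b
+-double-injective {zero}  {zero}  _ = refl
+-double-injective {suc a} {suc b} e =
  cong suc (+-double-injective (suc-injective
    (trans (sym (+-suc a a)) (trans (suc-injective e) (+-suc b b)))))

-- Schröder trees

-- node l r stands for "l, then a raised copy of r"; flat r for "r, then a flat".
data Tree : Set where
  leaf : Tree
  node : Tree → Tree → Tree
  flat : Tree → Tree

size : Tree → ℕ
size leaf       = 0
size (node l r) = suc (size l + size r)
size (flat r)   = suc (size r)

flatCount : Tree → ℕ
flatCount leaf       = 0
flatCount (node l r) = flatCount l + flatCount r
flatCount (flat r)   = suc (flatCount r)

-- 1. Trees ↔ Schröder paths

-- pathOnto t w: the path of t followed by w (last-return decomposition).
pathOnto : Tree → List Step → List Step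
pathOnto leaf       w = w
pathOnto (node l r) w = pathOnto l (U ∷ pathOnto r (D ∷ w))
pathOnto (flat r)   w = pathOnto r (F ∷ w)

path : Tree → List Step
path t = pathOnto t []

-- The parser keeps a stack of the completed trees below each open up-step
-- and the tree c built so far on the current level.
parseFrom : List Tree → Tree → List Step → Tree
parseFrom st       c []      = c
parseFrom st       c (U ∷ w) = parseFrom (c ∷ st) leaf w
parseFrom []       c (D ∷ w) = c
parseFrom (l ∷ st) c (D ∷ w) = parseFrom st (node l c) w
parseFrom st       c (F ∷ w) = parseFrom st (flat c) w

parse : List Step → Tree
parse = parseFrom [] leaf

-- The steps that lead the parser into a given stack, followed by w.
stackOnto : List Tree → List Step → List Step
stackOnto []       w = w
stackOnto (l ∷ st) w = stackOnto st (pathOnto l (U ∷ w))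

parse-pathOnto : ∀ t st w → parseFrom st leaf (pathOnto t w) ≡ parseFrom st t w
parse-pathOnto leaf       st w = refl
parse-pathOnto (node l r) st w =
  trans (parse-pathOnto l st _) (parse-pathOnto r (l ∷ st) (D ∷ w))
parse-pathOnto (flat r)   st w = parse-pathOnto r st (F ∷ w)

-- Validity at height h is unchanged by an up-step (to h+1) or a flat step;
-- these hold definitionally once h is known to be zero or a successor.
ValidFrom-U : ∀ h w → ValidFrom h (U ∷ w) ≡ ValidFrom (suc h) w
ValidFrom-U zero    w = refl
ValidFrom-U (suc h) w = refl

ValidFrom-F : ∀ h w → ValidFrom h (F ∷ w) ≡ ValidFrom h w
ValidFrom-F zero    w = refl
ValidFrom-F (suc h) w = refl

path-parseFrom : ∀ st c w → ValidFrom (length st) w →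
                 path (parseFrom st c w) ≡ stackOnto st (pathOnto c w)
path-parseFrom []       c []      v = refl
path-parseFrom (_ ∷ _)  c []      ()
path-parseFrom st       c (U ∷ w) v =
  path-parseFrom (c ∷ st) leaf w (subst id (ValidFrom-U (length st) w) v)
path-parseFrom []       c (D ∷ w) ()
path-parseFrom (l ∷ st) c (D ∷ w) v = path-parseFrom st (node l c) w v
path-parseFrom st       c (F ∷ w) v =
  path-parseFrom st (flat c) w (subst id (ValidFrom-F (length st) w) v)

pathOnto-valid : ∀ t h w → ValidFrom h w → ValidFrom h (pathOnto t w)
pathOnto-valid leaf       h w v = v
pathOnto-valid (node l r) h w v =
  pathOnto-valid l h _ (subst id (sym (ValidFrom-U h _))
    (pathOnto-valid r (suc h) (D ∷ w) v))
pathOnto-valid (flat r)   h w v =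
  pathOnto-valid r h (F ∷ w) (subst id (sym (ValidFrom-F h w)) v)

width-pathOnto : ∀ t w → width (pathOnto t w) ≡ (size t + size t) + width w
width-pathOnto leaf       w = refl
width-pathOnto (node l r) w =
  trans (width-pathOnto l _)
    (trans (cong (λ x → size l + size l + suc x) (width-pathOnto r (D ∷ w)))
      (regroup (size l) (size r) (width w)))
  where
  regroup : ∀ a b c → a + a + suc (b + b + suc c) ≡ suc (a + b) + suc (a + b) + c
  regroup = solve-∀
width-pathOnto (flat r)   w =
  trans (width-pathOnto r (F ∷ w)) (regroup (size r) (width w))
  where
  regroup : ∀ a c → a + a + suc (suc c) ≡ suc a + suc a + c
  regroup = solve-∀

flats-pathOnto : ∀ t w → flats (pathOnto t w) ≡ flatCount t + flats w
flats-pathOnto leaf       w = refl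
flats-pathOnto (node l r) w =
  trans (flats-pathOnto l _)
    (trans (cong (flatCount l +_) (flats-pathOnto r (D ∷ w)))
      (sym (+-assoc (flatCount l) (flatCount r) (flats w))))
flats-pathOnto (flat r)   w =
  trans (flats-pathOnto r (F ∷ w)) (+-suc (flatCount r) (flats w))

ValidFrom-irrelevant : ∀ h w → Irrelevant (ValidFrom h w)
ValidFrom-irrelevant zero    []      tt tt = refl
ValidFrom-irrelevant h       (U ∷ w) =
  subst Irrelevant (sym (ValidFrom-U h w)) (ValidFrom-irrelevant (suc h) w)
ValidFrom-irrelevant (suc h) (D ∷ w) = ValidFrom-irrelevant h w
ValidFrom-irrelevant h       (F ∷ w) =
  subst Irrelevant (sym (ValidFrom-F h w)) (ValidFrom-irrelevant h w)

trees↔paths : ∀ m j →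
  Σ Tree (λ t → size t ≡ m × flatCount t ≡ j)
    ↔ Σ (List Step) (λ w → IsSchroderPath m w × flats w ≡ j)
trees↔paths m j = Σ-↔ (λ t _ → path t) (λ w _ → parse w)
  (λ t (s , f) → ( pathOnto-valid t 0 [] tt
                 , trans (width-path t) (cong₂ _+_ s s) )
               , trans (flats-path t) f)
  (λ w ((v , wd) , f) →
     +-double-injective (trans (sym (width-path (parse w)))
                               (trans (cong width (path-parse w v)) wd))
   , trans (sym (flats-path (parse w))) (trans (cong flats (path-parse w v)) f))
  (λ t _ → parse-pathOnto t [] [])
  (λ w ((v , _) , _) → path-parse w v)
  (λ t → ×-irrelevant ≡-irrelevant ≡-irrelevant)
  (λ w → ×-irrelevant (×-irrelevant (ValidFrom-irrelevant 0 w) ≡-irrelevant)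
                      ≡-irrelevant)
  where
  path-parse : ∀ w → ValidFrom 0 w → path (parse w) ≡ w
  path-parse w = path-parseFrom [] leaf w
  width-path : ∀ t → width (path t) ≡ size t + size t
  width-path t = trans (width-pathOnto t []) (+-identityʳ _)
  flats-path : ∀ t → flats (path t) ≡ flatCount t
  flats-path t = trans (flats-pathOnto t []) (+-identityʳ _)

-- 2. Trees ↔ admissible codes

-- Letter z opens a level (it will be a zero entry); p d closes d open levels
-- and opens a new one (a positive entry exceeding the previous one by d).
data Letter : Set where
  z : Letter
  p : ℕ → Letter

Code : Set
Code = List Letter

CodeOK : ℕ → Code → Set
CodeOK h []        = ⊤
CodeOK h (z ∷ c)   = CodeOK (suc h) c
CodeOK h (p d ∷ c) = d ≤ h × CodeOK (suc (h ∸ d)) c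

zeroLetters : Code → ℕ
zeroLetters []        = 0
zeroLetters (z ∷ c)   = suc (zeroLetters c)
zeroLetters (p _ ∷ c) = zeroLetters c

-- The length of the right spine: the levels still open after reading code t.
trail : Tree → ℕ
trail leaf       = 0
trail (node l r) = suc (trail r)
trail (flat r)   = suc (trail r)

-- codeOnto t c: the code of t followed by c.  The levels closed at the end of
-- l are closed together with the opening of r, by a single letter p.
codeOnto : Tree → Code → Code
codeOnto leaf       c = c
codeOnto (node l r) c = codeOnto l (p (trail l) ∷ codeOnto r c)
codeOnto (flat r)   c = z ∷ codeOnto r c

code : Tree → Code
code t = codeOnto t []

-- An open level remembers how it was opened: by z, or by p above a tree l.
data Frame : Set where
  zF : Frame
  uF : Tree → Frame

close : Frame → Tree → Tree
close zF     c = flat c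
close (uF l) c = node l c

closeAll : List Frame → Tree → Tree
closeAll []       c = c
closeAll (f ∷ st) c = closeAll st (close f c)

-- The decoder: a stack machine over the open levels.  reopen d st t c closes
-- d more levels on top of the tree t, opens a new level and continues with c.
decodeFrom : List Frame → Code → Tree
reopen : ℕ → List Frame → Tree → Code → Tree
decodeFrom st []        = closeAll st leaf
decodeFrom st (z ∷ c)   = decodeFrom (zF ∷ st) c
decodeFrom st (p d ∷ c) = reopen d st leaf c
reopen zero    st       t c = decodeFrom (uF t ∷ st) c
reopen (suc d) []       t c = t
reopen (suc d) (f ∷ st) t c = reopen d st (close f t) c

decode : Code → Tree
decode = decodeFrom []

framesOnto : Tree → List Frame → List Frame
framesOnto leaf       st = st
framesOnto (node l r) st = framesOnto r (uF l ∷ st)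
framesOnto (flat r)   st = framesOnto r (zF ∷ st)

-- The letters that lead the decoder into a given stack, followed by c.
history : List Frame → Code → Code
history []          c = c
history (zF ∷ st)   c = history st (z ∷ c)
history (uF l ∷ st) c = history st (codeOnto l (p (trail l) ∷ c))

closeAll-frames : ∀ t st → closeAll (framesOnto t st) leaf ≡ closeAll st t
closeAll-frames leaf       st = refl
closeAll-frames (node l r) st = closeAll-frames r (uF l ∷ st)
closeAll-frames (flat r)   st = closeAll-frames r (zF ∷ st)

reopen-frames : ∀ t d st c →
  reopen (trail t + d) (framesOnto t st) leaf c ≡ reopen d st t c
reopen-frames leaf       d st c = refl
reopen-frames (node l r) d st c =
  trans (cong (λ k → reopen k (framesOnto r (uF l ∷ st)) leaf c) (sym (+-suc (trail r) d)))
        (reopen-frames r (suc d) (uF l ∷ st) c)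
reopen-frames (flat r)   d st c =
  trans (cong (λ k → reopen k (framesOnto r (zF ∷ st)) leaf c) (sym (+-suc (trail r) d)))
        (reopen-frames r (suc d) (zF ∷ st) c)

decode-codeOnto : ∀ t st c → decodeFrom st (codeOnto t c) ≡ decodeFrom (framesOnto t st) c
decode-codeOnto leaf       st c = refl
decode-codeOnto (node l r) st c = begin
  decodeFrom st (codeOnto l (p (trail l) ∷ codeOnto r c))
    ≡⟨ decode-codeOnto l st _ ⟩
  reopen (trail l) (framesOnto l st) leaf (codeOnto r c)
    ≡⟨ cong (λ k → reopen k (framesOnto l st) leaf (codeOnto r c)) (sym (+-identityʳ (trail l))) ⟩
  reopen (trail l + 0) (framesOnto l st) leaf (codeOnto r c)
    ≡⟨ reopen-frames l 0 st (codeOnto r c) ⟩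
  decodeFrom (uF l ∷ st) (codeOnto r c)
    ≡⟨ decode-codeOnto r (uF l ∷ st) c ⟩
  decodeFrom (framesOnto r (uF l ∷ st)) c ∎
  where open ≡-Reasoning
decode-codeOnto (flat r)   st c = decode-codeOnto r (zF ∷ st) c

decode-code : ∀ t → decode (code t) ≡ t
decode-code t = trans (decode-codeOnto t [] []) (closeAll-frames t [])

codeOnto-closeAll : ∀ st t c → codeOnto (closeAll st t) c ≡ history st (codeOnto t c)
codeOnto-closeAll []          t c = refl
codeOnto-closeAll (zF ∷ st)   t c = codeOnto-closeAll st (flat t) c
codeOnto-closeAll (uF l ∷ st) t c = codeOnto-closeAll st (node l t) c

code-decodeFrom : ∀ st c → CodeOK (length st) c → code (decodeFrom st c) ≡ history st c
code-reopen : ∀ d st t c → d ≤ length st → CodeOK (suc (length st ∸ d)) c →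
  code (reopen d st t c) ≡ history st (codeOnto t (p (d + trail t) ∷ c))
code-decodeFrom st []        _        = codeOnto-closeAll st leaf []
code-decodeFrom st (z ∷ c)   ok       = code-decodeFrom (zF ∷ st) c ok
code-decodeFrom st (p d ∷ c) (le , ok) =
  trans (code-reopen d st leaf c le ok)
        (cong (λ k → history st (p k ∷ c)) (+-identityʳ d))
code-reopen zero    st          t c _       ok = code-decodeFrom (uF t ∷ st) c ok
code-reopen (suc d) (zF ∷ st)   t c (s≤s le) ok =
  trans (code-reopen d st (flat t) c le ok)
        (cong (λ k → history st (z ∷ codeOnto t (p k ∷ c))) (+-suc d (trail t)))
code-reopen (suc d) (uF l ∷ st) t c (s≤s le) ok =
  trans (code-reopen d st (node l t) c le ok)
        (cong (λ k → history st (codeOnto l (p (trail l) ∷ codeOnto t (p k ∷ c))))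
              (+-suc d (trail t)))

code-decode : ∀ c → CodeOK 0 c → code (decode c) ≡ c
code-decode = code-decodeFrom []

codeOnto-ok : ∀ t h c → CodeOK (trail t + h) c → CodeOK h (codeOnto t c)
codeOnto-ok leaf       h c ok = ok
codeOnto-ok (node l r) h c ok =
  codeOnto-ok l h _
    ( m≤m+n (trail l) h
    , subst (λ k → CodeOK (suc k) (codeOnto r c)) (sym (m+n∸m≡n (trail l) h))
        (codeOnto-ok r (suc h) c (subst (λ k → CodeOK k c) (sym (+-suc (trail r) h)) ok)))
codeOnto-ok (flat r)   h c ok =
  codeOnto-ok r (suc h) c (subst (λ k → CodeOK k c) (sym (+-suc (trail r) h)) ok)

length-codeOnto : ∀ t c → length (codeOnto t c) ≡ size t + length c
length-codeOnto leaf       c = refl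
length-codeOnto (node l r) c =
  trans (length-codeOnto l _)
    (trans (cong (λ x → size l + suc x) (length-codeOnto r c))
      (regroup (size l) (size r) (length c)))
  where
  regroup : ∀ a b n → a + suc (b + n) ≡ suc (a + b) + n
  regroup = solve-∀
length-codeOnto (flat r)   c = cong suc (length-codeOnto r c)

zeroLetters-codeOnto : ∀ t c → zeroLetters (codeOnto t c) ≡ flatCount t + zeroLetters c
zeroLetters-codeOnto leaf       c = refl
zeroLetters-codeOnto (node l r) c =
  trans (zeroLetters-codeOnto l _)
    (trans (cong (flatCount l +_) (zeroLetters-codeOnto r c))
      (sym (+-assoc (flatCount l) (flatCount r) (zeroLetters c))))
zeroLetters-codeOnto (flat r)   c = cong suc (zeroLetters-codeOnto r c)

CodeOK-irrelevant : ∀ h c → Irrelevant (CodeOK h c)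
CodeOK-irrelevant h []        tt tt = refl
CodeOK-irrelevant h (z ∷ c)   = CodeOK-irrelevant (suc h) c
CodeOK-irrelevant h (p d ∷ c) = ×-irrelevant ≤-irrelevant (CodeOK-irrelevant _ c)

codes↔trees : ∀ m j →
  Σ Code (λ c → CodeOK 0 c × length c ≡ m × zeroLetters c ≡ j)
    ↔ Σ Tree (λ t → size t ≡ m × flatCount t ≡ j)
codes↔trees m j = Σ-↔ (λ c _ → decode c) (λ t _ → code t)
  (λ c (ok , len , zs) →
       trans (sym (length-code (decode c))) (trans (cong length (code-decode c ok)) len)
     , trans (sym (zeroLetters-code (decode c))) (trans (cong zeroLetters (code-decode c ok)) zs))
  (λ t (s , f) → codeOnto-ok t 0 [] tt
               , trans (length-code t) s
               , trans (zeroLetters-code t) f)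
  (λ c (ok , _) → code-decode c ok)
  (λ t _ → decode-code t)
  (λ c → ×-irrelevant (CodeOK-irrelevant 0 c) (×-irrelevant ≡-irrelevant ≡-irrelevant))
  (λ t → ×-irrelevant ≡-irrelevant ≡-irrelevant)
  where
  length-code : ∀ t → length (code t) ≡ size t
  length-code t = trans (length-codeOnto t []) (+-identityʳ _)
  zeroLetters-code : ∀ t → zeroLetters (code t) ≡ flatCount t
  zeroLetters-code t = trans (zeroLetters-codeOnto t []) (+-identityʳ _)

-- 3. Admissible tails ↔ admissible codes

-- Adm l b t: the positive entries of t are > l and weakly increasing, and
-- the entry at index i is at most b + i + 1.
Adm : ∀ {k} → ℕ → ℕ → Vec ℕ k → Set
Adm l b []          = ⊤
Adm l b (zero  ∷ t) = Adm l (suc b) t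
Adm l b (suc y ∷ t) = l ≤ y × y ≤ b × Adm y (suc b) t

zeroCount : ∀ {k} → Vec ℕ k → ℕ
zeroCount []          = 0
zeroCount (zero  ∷ t) = suc (zeroCount t)
zeroCount (suc _ ∷ t) = zeroCount t

-- Encode a tail by its zeros and the increments of its positive entries;
-- l is the last positive entry minus one (or 0).
toCode : ∀ {k} → ℕ → Vec ℕ k → Code
toCode l []          = []
toCode l (zero  ∷ t) = z ∷ toCode l t
toCode l (suc y ∷ t) = p (y ∸ l) ∷ toCode y t

fromCode : (k : ℕ) → ℕ → Code → Vec ℕ k
fromCode zero    l c         = []
fromCode (suc k) l []        = 0 ∷ fromCode k l []
fromCode (suc k) l (z ∷ c)   = 0 ∷ fromCode k l c
fromCode (suc k) l (p d ∷ c) = suc (l + d) ∷ fromCode k (l + d) c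

fromCode-toCode : ∀ {k} l b (t : Vec ℕ k) → Adm l b t → fromCode k l (toCode l t) ≡ t
fromCode-toCode l b []          _               = refl
fromCode-toCode l b (zero  ∷ t) adm             = cong (0 ∷_) (fromCode-toCode l (suc b) t adm)
fromCode-toCode l b (suc y ∷ t) (l≤y , _ , adm)
  rewrite m+[n∸m]≡n l≤y = cong (suc y ∷_) (fromCode-toCode y (suc b) t adm)

toCode-fromCode : ∀ k l c → length c ≡ k → toCode l (fromCode k l c) ≡ c
toCode-fromCode zero    l []        _   = refl
toCode-fromCode (suc k) l (z ∷ c)   len = cong (z ∷_) (toCode-fromCode k l c (suc-injective len))
toCode-fromCode (suc k) l (p d ∷ c) len =
  cong₂ _∷_ (cong p (m+n∸m≡n l d)) (toCode-fromCode k (l + d) c (suc-injective len))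

length-toCode : ∀ {k} l (t : Vec ℕ k) → length (toCode l t) ≡ k
length-toCode l []          = refl
length-toCode l (zero  ∷ t) = cong suc (length-toCode l t)
length-toCode l (suc y ∷ t) = cong suc (length-toCode y t)

zeroLetters-toCode : ∀ {k} l (t : Vec ℕ k) → zeroLetters (toCode l t) ≡ zeroCount t
zeroLetters-toCode l []          = refl
zeroLetters-toCode l (zero  ∷ t) = cong suc (zeroLetters-toCode l t)
zeroLetters-toCode l (suc y ∷ t) = zeroLetters-toCode y t

-- The number of open levels of the code is the slack b ∸ l of the tail.
slack-suc : ∀ {l b} → l ≤ b → suc b ∸ l ≡ suc (b ∸ l)
slack-suc = +-∸-assoc 1

toCode-ok : ∀ {k} l b (t : Vec ℕ k) → l ≤ b → Adm l b t → CodeOK (b ∸ l) (toCode l t)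
toCode-ok l b []          _   _                 = tt
toCode-ok l b (zero  ∷ t) l≤b adm               =
  subst (λ h → CodeOK h (toCode l t)) (slack-suc l≤b)
    (toCode-ok l (suc b) t (m≤n⇒m≤1+n l≤b) adm)
toCode-ok l b (suc y ∷ t) l≤b (l≤y , y≤b , adm) =
    ∸-monoˡ-≤ l y≤b
  , subst (λ h → CodeOK (suc h) (toCode y t)) slack
      (subst (λ h → CodeOK h (toCode y t)) (slack-suc y≤b)
        (toCode-ok y (suc b) t (m≤n⇒m≤1+n y≤b) adm))
  where
  slack : b ∸ y ≡ (b ∸ l) ∸ (y ∸ l)
  slack = sym (trans (∸-+-assoc b l (y ∸ l)) (cong (b ∸_) (m+[n∸m]≡n l≤y)))

fromCode-adm : ∀ k l b c → l ≤ b → CodeOK (b ∸ l) c → Adm l b (fromCode k l c)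
fromCode-adm zero    l b c         _   _ = tt
fromCode-adm (suc k) l b []        l≤b _ = fromCode-adm k l (suc b) [] (m≤n⇒m≤1+n l≤b) tt
fromCode-adm (suc k) l b (z ∷ c)   l≤b ok =
  fromCode-adm k l (suc b) c (m≤n⇒m≤1+n l≤b)
    (subst (λ h → CodeOK h c) (sym (slack-suc l≤b)) ok)
fromCode-adm (suc k) l b (p d ∷ c) l≤b (d≤ , ok) =
    m≤m+n l d
  , l+d≤b
  , fromCode-adm k (l + d) (suc b) c (m≤n⇒m≤1+n l+d≤b)
      (subst (λ h → CodeOK h c) (sym (slack-suc l+d≤b))
        (subst (λ h → CodeOK (suc h) c) (∸-+-assoc b l d) ok))
  where
  l+d≤b : l + d ≤ b
  l+d≤b = subst (_≤ b) (+-comm d l) (m≤o∸n⇒m+n≤o d l≤b d≤)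

Adm-irrelevant : ∀ {k} l b (t : Vec ℕ k) → Irrelevant (Adm l b t)
Adm-irrelevant l b []          tt tt = refl
Adm-irrelevant l b (zero  ∷ t) = Adm-irrelevant l (suc b) t
Adm-irrelevant l b (suc y ∷ t) =
  ×-irrelevant ≤-irrelevant (×-irrelevant ≤-irrelevant (Adm-irrelevant y (suc b) t))

tails↔codes : ∀ m j →
  Σ (Vec ℕ m) (λ t → Adm 0 0 t × zeroCount t ≡ j)
    ↔ Σ Code (λ c → CodeOK 0 c × length c ≡ m × zeroLetters c ≡ j)
tails↔codes m j = Σ-↔ (λ t _ → toCode 0 t) (λ c _ → fromCode m 0 c)
  (λ t (adm , zs) → toCode-ok 0 0 t z≤n adm
                  , length-toCode 0 t
                  , trans (zeroLetters-toCode 0 t) zs)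
  (λ c (ok , len , zs) →
       fromCode-adm m 0 0 c z≤n ok
     , trans (sym (zeroLetters-toCode 0 (fromCode m 0 c)))
             (trans (cong zeroLetters (toCode-fromCode m 0 c len)) zs))
  (λ t (adm , _) → fromCode-toCode 0 0 t adm)
  (λ c (_ , len , _) → toCode-fromCode m 0 c len)
  (λ t → ×-irrelevant (Adm-irrelevant 0 0 t) ≡-irrelevant)
  (λ c → ×-irrelevant (CodeOK-irrelevant 0 c) (×-irrelevant ≡-irrelevant ≡-irrelevant))

-- 4. 021-avoiding inversion sequences ↔ admissible tails

Has021 : ∀ {n} → Vec ℕ n → Set
Has021 {n} v = Σ (Fin n) λ i → Σ (Fin n) λ j → Σ (Fin n) λ k →
  toℕ i < toℕ j × toℕ j < toℕ k × lookup v i < lookup v k × lookup v k < lookup v j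

T-not : ∀ b → ¬ T b → T (not b)
T-not true  ¬b = ¬b tt
T-not false _  = tt

T-not⁻ : ∀ b → T (not b) → ¬ T b
T-not⁻ true  () _
T-not⁻ false _  ()

any-allFin⁺ : ∀ {n} (f : Fin n → Bool) i → T (f i) → T (any f (allFin n))
any-allFin⁺ f i fi = Any.any⁺ f (Any.tabulate⁺ i fi)

any-allFin⁻ : ∀ {n} (f : Fin n → Bool) → T (any f (allFin n)) → Σ (Fin n) (λ i → T (f i))
any-allFin⁻ f t = Any.tabulate⁻ (Any.any⁻ f _ t)

occurs⁺ : ∀ {n} (e : InvSeq n) i j k → toℕ i < toℕ j → toℕ j < toℕ k →
  val e i < val e k → val e k < val e j → T (Occ021 e i j k)
occurs⁺ e i j k a b c d =
  both (<⇒<ᵇ a , both (<⇒<ᵇ b , both (<⇒<ᵇ c , <⇒<ᵇ d)))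
  where
  both : ∀ {x y} → T x × T y → T (x ∧ y)
  both = Equivalence.from T-∧

occurs⁻ : ∀ {n} (e : InvSeq n) i j k → T (Occ021 e i j k) → Has021 (proj₁ e)
occurs⁻ e i j k occ with Equivalence.to T-∧ occ
... | a , occ′ with Equivalence.to T-∧ occ′
... | b , occ″ with Equivalence.to T-∧ occ″
... | c , d = i , j , k , <ᵇ⇒< _ _ a , <ᵇ⇒< _ _ b , <ᵇ⇒< _ _ c , <ᵇ⇒< _ _ d

avoids⇒noPattern : ∀ {n} (e : InvSeq n) → Avoids021 e → ¬ Has021 (proj₁ e)
avoids⇒noPattern e av (i , j , k , a , b , c , d) =
  T-not⁻ _ av (any-allFin⁺ _ i (any-allFin⁺ _ j (any-allFin⁺ _ k (occurs⁺ e i j k a b c d))))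

noPattern⇒avoids : ∀ {n} (e : InvSeq n) → ¬ Has021 (proj₁ e) → Avoids021 e
noPattern⇒avoids e np = T-not _ λ occ →
  let (i , occ₁) = any-allFin⁻ _ occ
      (j , occ₂) = any-allFin⁻ _ occ₁
      (k , occ₃) = any-allFin⁻ _ occ₂
  in np (occurs⁻ e i j k occ₃)

Monotone : ∀ {k} → Vec ℕ k → Set
Monotone {k} t = ∀ (i j : Fin k) → toℕ i < toℕ j → lookup t j ≡ 0 ⊎ lookup t i ≤ lookup t j

Above : ∀ {k} → ℕ → Vec ℕ k → Set
Above {k} l t = ∀ (i : Fin k) → lookup t i ≡ 0 ⊎ l < lookup t i

Bounded : ∀ {k} → ℕ → Vec ℕ k → Set
Bounded {k} b t = ∀ (i : Fin k) → lookup t i ≤ suc (b + toℕ i)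

-- Key lemma: a sequence starting with 0 avoids 021 iff its positive
-- entries weakly increase (the leading 0 plays the role of the "0").
noPattern⇒monotone : ∀ {k} (t : Vec ℕ k) → ¬ Has021 (0 ∷ t) → Monotone t
noPattern⇒monotone t np i j i<j with lookup t j in eq
... | zero  = inj₁ refl
... | suc y with lookup t i ≤? suc y
...   | yes le = inj₂ le
...   | no  gt = ⊥-elim (np ( fzero , fsuc i , fsuc j , s≤s z≤n , s≤s i<j
                            , subst (0 <_) (sym eq) (s≤s z≤n)
                            , subst (_< lookup t i) (sym eq) (≰⇒> gt)))

monotone⇒noPattern : ∀ {k} (t : Vec ℕ k) → Monotone t → ¬ Has021 (0 ∷ t)
monotone⇒noPattern t mono (i , fzero  , _      , () , _)
monotone⇒noPattern t mono (i , fsuc j , fzero  , _ , () , _)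
monotone⇒noPattern t mono (i , fsuc j , fsuc k , _ , s≤s j<k , vi<vk , vk<vj)
  with mono j k j<k
... | inj₁ tk≡0  = n≮0 (subst (lookup (0 ∷ t) i <_) tk≡0 vi<vk)
... | inj₂ tj≤tk = <⇒≱ vk<vj tj≤tk

bounded-tail : ∀ {k} b x (t : Vec ℕ k) → Bounded b (x ∷ t) → Bounded (suc b) t
bounded-tail b x t bd i = subst (lookup t i ≤_) (cong suc (+-suc b (toℕ i))) (bd (fsuc i))

monotone-tail : ∀ {k} x (t : Vec ℕ k) → Monotone (x ∷ t) → Monotone t
monotone-tail x t mono i j i<j = mono (fsuc i) (fsuc j) (s≤s i<j)

-- Adm l b t is exactly the conjunction Bounded b t × Above l t × Monotone t.
adm⇒above : ∀ {k} l b (t : Vec ℕ k) → Adm l b t → Above l t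
adm⇒above l b (zero  ∷ t) adm fzero    = inj₁ refl
adm⇒above l b (zero  ∷ t) adm (fsuc i) = adm⇒above l (suc b) t adm i
adm⇒above l b (suc y ∷ t) (l≤y , _ , adm) fzero    = inj₂ (s≤s l≤y)
adm⇒above l b (suc y ∷ t) (l≤y , _ , adm) (fsuc i) with adm⇒above y (suc b) t adm i
... | inj₁ ti≡0 = inj₁ ti≡0
... | inj₂ y<ti = inj₂ (≤-trans (s≤s l≤y) y<ti)

adm⇒bounded : ∀ {k} l b (t : Vec ℕ k) → Adm l b t → Bounded b t
adm⇒bounded l b (zero  ∷ t) adm fzero    = z≤n
adm⇒bounded l b (suc y ∷ t) (_ , y≤b , _) fzero =
  s≤s (subst (y ≤_) (sym (+-identityʳ b)) y≤b)
adm⇒bounded l b (x ∷ t) adm (fsuc i) =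
  subst (lookup t i ≤_) (sym (cong suc (+-suc b (toℕ i)))) (bounded-rest x adm i)
  where
  bounded-rest : ∀ x → Adm l b (x ∷ t) → Bounded (suc b) t
  bounded-rest zero    adm           = adm⇒bounded l (suc b) t adm
  bounded-rest (suc y) (_ , _ , adm) = adm⇒bounded y (suc b) t adm

adm⇒monotone : ∀ {k} l b (t : Vec ℕ k) → Adm l b t → Monotone t
adm⇒monotone l b (zero  ∷ t) adm fzero    (fsuc j) _ = inj₂ z≤n
adm⇒monotone l b (zero  ∷ t) adm (fsuc i) (fsuc j) (s≤s i<j) =
  adm⇒monotone l (suc b) t adm i j i<j
adm⇒monotone l b (suc y ∷ t) (_ , _ , adm) fzero    (fsuc j) _ =
  adm⇒above y (suc b) t adm j
adm⇒monotone l b (suc y ∷ t) (_ , _ , adm) (fsuc i) (fsuc j) (s≤s i<j) =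
  adm⇒monotone y (suc b) t adm i j i<j

conditions⇒adm : ∀ {k} l b (t : Vec ℕ k) → Bounded b t → Above l t → Monotone t → Adm l b t
conditions⇒adm l b []          _  _     _    = tt
conditions⇒adm l b (zero  ∷ t) bd above mono =
  conditions⇒adm l (suc b) t (bounded-tail b 0 t bd) (λ i → above (fsuc i))
    (monotone-tail 0 t mono)
conditions⇒adm l b (suc y ∷ t) bd above mono with above fzero | bd fzero
... | inj₁ ()       | _
... | inj₂ (s≤s l≤y) | s≤s y≤b+0 =
    l≤y
  , subst (y ≤_) (+-identityʳ b) y≤b+0
  , conditions⇒adm y (suc b) t (bounded-tail b (suc y) t bd)
      (λ i → mono fzero (fsuc i) (s≤s z≤n)) (monotone-tail (suc y) t mono)

filter-zeros : ∀ {A : Set} (f : A → ℕ) {n} (g : Fin n → A) →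
  length (filter (λ a → f a ≟ 0) (tabulate g)) ≡ zeroCount (Vec.tabulate (λ i → f (g i)))
filter-zeros f {zero}  g = refl
filter-zeros f {suc n} g with f (g fzero) | filter-zeros f (λ i → g (fsuc i))
... | zero  | ih = cong suc ih
... | suc _ | ih = ih

zeros-zeroCount : ∀ {n} (e : InvSeq n) → zeros e ≡ zeroCount (proj₁ e)
zeros-zeroCount (v , _) =
  trans (filter-zeros (lookup v) id) (cong zeroCount (tabulate∘lookup v))

IsInvSeq-irrelevant : ∀ {n} (v : Vec ℕ n) → Irrelevant (IsInvSeq v)
IsInvSeq-irrelevant v = All.irrelevant <-irrelevant

sequences↔tails : ∀ m j →
  Σ (InvSeq (suc m)) (λ e → Avoids021 e × zeros e ≡ suc j)
    ↔ Σ (Vec ℕ m) (λ t → Adm 0 0 t × zeroCount t ≡ j)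
sequences↔tails m j = Σ-↔ (λ e _ → Vec.tail (proj₁ e)) (λ t (adm , _) → 0 ∷ t , inv-of adm)
  tail-ok
  (λ t (adm , zs) →
       noPattern⇒avoids (0 ∷ t , inv-of adm) (monotone⇒noPattern t (adm⇒monotone 0 0 t adm))
     , trans (zeros-zeroCount (0 ∷ t , inv-of adm)) (cong suc zs))
  cons-tail
  (λ t _ → refl)
  (λ e → ×-irrelevant T-irrelevant ≡-irrelevant)
  (λ t → ×-irrelevant (Adm-irrelevant 0 0 t) ≡-irrelevant)
  where
  inv-of : ∀ {t : Vec ℕ m} → Adm 0 0 t → IsInvSeq (0 ∷ t)
  inv-of {t} adm = All.tabulate⁺ {f = id} λ
    { fzero    → s≤s z≤n
    ; (fsuc i) → s≤s (adm⇒bounded 0 0 t adm i) }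

  tail-ok : ∀ e → Avoids021 e × zeros e ≡ suc j →
            Adm 0 0 (Vec.tail (proj₁ e)) × zeroCount (Vec.tail (proj₁ e)) ≡ j
  tail-ok (zero ∷ t , inv) (av , zs) =
      conditions⇒adm 0 0 t
        (λ i → ≤-pred (All.tabulate⁻ {f = id} inv (fsuc i)))
        (λ i → above-zero (lookup t i))
        (noPattern⇒monotone t (avoids⇒noPattern (zero ∷ t , inv) av))
    , suc-injective (trans (sym (zeros-zeroCount (zero ∷ t , inv))) zs)
    where
    above-zero : ∀ x → x ≡ 0 ⊎ 0 < x
    above-zero zero    = inj₁ refl
    above-zero (suc x) = inj₂ (s≤s z≤n)
  tail-ok (suc _ ∷ _ , (s≤s () All.∷ _)) _

  cons-tail : ∀ e (ok : Avoids021 e × zeros e ≡ suc j) →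
              (0 ∷ Vec.tail (proj₁ e) , inv-of (proj₁ (tail-ok e ok))) ≡ e
  cons-tail (zero ∷ t , inv) _ = cong (zero ∷ t ,_) (IsInvSeq-irrelevant (0 ∷ t) _ _)
  cons-tail (suc _ ∷ _ , (s≤s () All.∷ _)) _

theorem4 : (m j : ℕ) →
    (Σ (InvSeq (suc m)) (λ e → Avoids021 e × zeros e ≡ suc j))
      ↔ (Σ (List Step) (λ p → IsSchroderPath m p × flats p ≡ j))
theorem4 m j =
  ↔-trans (sequences↔tails m j)
    (↔-trans (tails↔codes m j)
      (↔-trans (codes↔trees m j) (trees↔paths m j)))
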